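{- For integers $n,k \geqslant 0$, let $\mathfrak{C}_{n,k}$ be the set of words $\omega = (\omega_1, \dots, \omega_n)$ of length $n$ over the alphabet $\{1, \dots, k\}$ that avoid both patterns $010$ and $000$, contain every letter of $\{1, \dots, k\}$, and satisfy $\omega_1 = k$. Let $\mathfrak{c}_{n,k} = \#\mathfrak{C}_{n,k}$. Then for all $n, k \geqslant 2$, $$\mathfrak{c}_{n,k} = (n-1) \cdot \mathfrak{c}_{n-1,k-1} + (n-2) \cdot \mathfrak{c}_{n-2,k-1}.$$
   Context: A word $\sigma$ contains a pattern $p=(p_1,\dots,p_k)$ if some subsequence $(\sigma_{i_1},\dots,\sigma_{i_k})$ with $i_1<\dots<i_k$ is order-isomorphic to $p$; otherwise it avoids $p$. Avoiding $010$ means no indices $a<b<c$ with $\sigma_a=\sigma_c<\sigma_b$; avoiding $000$ means no letter occurs three or more times. -}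

module Defs where

open import Data.Nat using (ℕ; suc; _<_)
open import Data.Fin using (Fin; toℕ; fromℕ; zero) renaming (_<_ to _<ᶠ_)
open import Data.Vec using (Vec; lookup)
open import Data.Product using (∃; ∃-syntax; _×_)
open import Data.List using (List)
open import Data.List.Membership.Propositional using (_∈_)
open import Data.List.Relation.Unary.Unique.Propositional using (Unique)
open import Relation.Binary.PropositionalEquality using (_≡_)
open import Relation.Nullary using (¬_)
open import Function.Bundles using (_⇔_)

-- A word of length n over the alphabet {1,…,k}; letter j+1 is represented by (j : Fin k).
Word : ℕ → ℕ → Set
Word n k = Vec (Fin k) n

Contains010 : ∀ {n k} → Word n k → Set
Contains010 {n} ω = ∃[ a ] ∃[ b ] ∃[ c ]
  (toℕ {n} a < toℕ b × toℕ b < toℕ c ×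
   lookup ω a ≡ lookup ω c × lookup ω a <ᶠ lookup ω b)

Contains000 : ∀ {n k} → Word n k → Set
Contains000 {n} ω = ∃[ a ] ∃[ b ] ∃[ c ]
  (toℕ {n} a < toℕ b × toℕ b < toℕ c ×
   lookup ω a ≡ lookup ω b × lookup ω b ≡ lookup ω c)

Surjective : ∀ {n k} → Word n k → Set
Surjective {n} {k} ω = (x : Fin k) → ∃[ i ] lookup {n = n} ω i ≡ x

data InC : (n k : ℕ) → Word n k → Set where
  inC : ∀ {n k} (ω : Word (suc n) (suc k)) →
        ¬ Contains010 ω → ¬ Contains000 ω → Surjective ω →
        lookup ω zero ≡ fromℕ k → InC (suc n) (suc k) ω

-- L is a duplicate-free enumeration of 𝔆_{n,k}; its length is 𝔠_{n,k}.
Enumerates : (n k : ℕ) → List (Word n k) → Set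
Enumerates n k L = Unique L × (∀ ω → (ω ∈ L) ⇔ InC n k ω)

-- In a word of 𝔆_{n+2,k+2} the letter 1 occurs once or twice, and twice only as an adjacent pair:
-- a letter strictly between two 1s would create 010, or 000 if it is itself a 1.  As the first
-- letter is k+2, a single 1 stands at one of the n+1 positions 2,…,n+2 and a pair at one of the
-- n places (2,3),…,(n+1,n+2).  Deleting the 1s and lowering the other letters by one gives a word
-- of 𝔆_{n+1,k+1} resp. 𝔆_{n,k+1}; together with the position this is a bijection, because no
-- occurrence of 010 or 000 can use letters from a block of at most two adjacent 1s.

module Submission where

open import Defs
open import Data.Empty using (⊥; ⊥-elim)
open import Data.Fin using (Fin; zero; suc; toℕ; inject₁; punchIn; punchOut; _≟_)
import Data.Fin.Properties as Fin
open import Data.List using (List; length; map; _++_; allFin; cartesianProduct)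
import Data.List.Properties as List
open import Data.List.Membership.Propositional using (_∈_)
open import Data.List.Membership.Propositional.Properties
  using (∈-map⁺; ∈-map⁻; ∈-++⁻; ∈-++⁺ˡ; ∈-++⁺ʳ; ∈-cartesianProduct⁺; ∈-cartesianProduct⁻; ∈-allFin)
open import Data.List.Membership.Propositional.Properties.WithK using (unique∧set⇒bag)
open import Data.List.Relation.Binary.BagAndSetEquality using (∼bag⇒↭)
open import Data.List.Relation.Binary.Permutation.Propositional.Properties using (↭-length)
open import Data.List.Relation.Unary.Unique.Propositional using (Unique)
import Data.List.Relation.Unary.Unique.Propositional.Properties as Unique
open import Data.Nat as ℕ using (ℕ; _+_; _*_; _≤_; _<_; s≤s; z≤n)
import Data.Nat.Properties as ℕ
open import Data.Product using (∃₂; ∃-syntax; _×_; _,_; proj₁; proj₂)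
open import Data.Sum as Sum using (_⊎_; inj₁; inj₂)
open import Data.Sum.Properties using (inj₁-injective; inj₂-injective)
open import Data.Vec as Vec using (Vec; []; _∷_; lookup; insertAt; removeAt)
import Data.Vec.Properties as Vec
open import Function using (_∘_)
open import Function.Bundles using (_⇔_; mk⇔; Equivalence)
open import Relation.Binary.Definitions using (tri<; tri≈; tri>)
open import Relation.Binary.PropositionalEquality
open import Relation.Nullary using (yes; no; ¬_)
open import Relation.Nullary.Decidable using (¬?; _×-dec_)

private
  variable
    m n k : ℕ

length-≡-by-bijection : ∀ {A B : Set} (f : A → B) {xs : List A} {ys : List B} →
  Unique xs → Unique ys → (∀ {x y} → f x ≡ f y → x ≡ y) →
  (∀ {x} → x ∈ xs → f x ∈ ys) → (∀ {y} → y ∈ ys → ∃[ x ] (x ∈ xs × f x ≡ y)) →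
  length ys ≡ length xs
length-≡-by-bijection f {xs} {ys} xs! ys! f-inj into onto =
  trans (↭-length (∼bag⇒↭ (unique∧set⇒bag ys! (Unique.map⁺ f-inj xs!) (mk⇔ to from))))
        (List.length-map f xs)
  where
  to : ∀ {y} → y ∈ ys → y ∈ map f xs
  to y∈ys with onto y∈ys
  ... | x , x∈xs , refl = ∈-map⁺ f x∈xs
  from : ∀ {y} → y ∈ map f xs → y ∈ ys
  from y∈fxs with ∈-map⁻ f y∈fxs
  ... | x , x∈xs , refl = into x∈xs

length-cartesianProduct : ∀ {A B : Set} (xs : List A) (ys : List B) →
  length (cartesianProduct xs ys) ≡ length xs * length ys
length-cartesianProduct List.[] ys = refl
length-cartesianProduct (x List.∷ xs) ys = begin
  length (map (x ,_) ys ++ cartesianProduct xs ys)        ≡⟨ List.length-++ (map (x ,_) ys) ⟩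
  length (map (x ,_) ys) + length (cartesianProduct xs ys) ≡⟨ cong₂ _+_ (List.length-map (x ,_) ys)
                                                                         (length-cartesianProduct xs ys) ⟩
  length ys + length xs * length ys                       ∎
  where open ≡-Reasoning

length-allFin-product : ∀ {A : Set} n (xs : List A) →
  length (cartesianProduct (allFin n) xs) ≡ n * length xs
length-allFin-product n xs =
  trans (length-cartesianProduct (allFin n) xs) (cong (_* length xs) (List.length-tabulate {n = n} (λ i → i)))

tagged : ∀ {A B : Set} → List A → List B → List (A ⊎ B)
tagged xs ys = map inj₁ xs ++ map inj₂ ys

module _ {A B : Set} {xs : List A} {ys : List B} where

  length-tagged : length (tagged xs ys) ≡ length xs + length ys
  length-tagged = trans (List.length-++ (map inj₁ xs)) (cong₂ _+_ (List.length-map inj₁ xs) (List.length-map inj₂ ys))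

  tagged-unique : Unique xs → Unique ys → Unique (tagged xs ys)
  tagged-unique xs! ys! = Unique.++⁺ (Unique.map⁺ inj₁-injective xs!) (Unique.map⁺ inj₂-injective ys!)
    (λ (c∈₁ , c∈₂) → inj₁≢inj₂ (∈-map⁻ inj₁ c∈₁) (∈-map⁻ inj₂ c∈₂))
    where
    inj₁≢inj₂ : ∀ {c : A ⊎ B} → ∃[ x ] (x ∈ xs × c ≡ inj₁ x) → ∃[ y ] (y ∈ ys × c ≡ inj₂ y) → ⊥
    inj₁≢inj₂ (_ , _ , refl) (_ , _ , ())

  ∈-taggedˡ⁺ : ∀ {x} → x ∈ xs → inj₁ x ∈ tagged xs ys
  ∈-taggedˡ⁺ x∈xs = ∈-++⁺ˡ (∈-map⁺ inj₁ x∈xs)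

  ∈-taggedʳ⁺ : ∀ {y} → y ∈ ys → inj₂ y ∈ tagged xs ys
  ∈-taggedʳ⁺ y∈ys = ∈-++⁺ʳ (map inj₁ xs) (∈-map⁺ inj₂ y∈ys)

  ∈-taggedˡ⁻ : ∀ {x} → inj₁ x ∈ tagged xs ys → x ∈ xs
  ∈-taggedˡ⁻ x∈ with ∈-++⁻ (map inj₁ xs) x∈
  ... | inj₁ x∈₁ with ∈-map⁻ inj₁ x∈₁
  ...   | _ , x∈xs , refl = x∈xs
  ∈-taggedˡ⁻ x∈ | inj₂ x∈₂ with ∈-map⁻ inj₂ x∈₂
  ...   | _ , _ , ()

  ∈-taggedʳ⁻ : ∀ {y} → inj₂ y ∈ tagged xs ys → y ∈ ys
  ∈-taggedʳ⁻ y∈ with ∈-++⁻ (map inj₁ xs) y∈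
  ... | inj₁ y∈₁ with ∈-map⁻ inj₁ y∈₁
  ...   | _ , _ , ()
  ∈-taggedʳ⁻ y∈ | inj₂ y∈₂ with ∈-map⁻ inj₂ y∈₂
  ...   | _ , y∈ys , refl = y∈ys

punchIn-or-pivot : ∀ (i x : Fin (1 + n)) → x ≡ i ⊎ ∃[ y ] punchIn i y ≡ x
punchIn-or-pivot i x with x ≟ i
... | yes x≡i = inj₁ x≡i
... | no x≢i = inj₂ (punchOut (x≢i ∘ sym) , Fin.punchIn-punchOut (x≢i ∘ sym))

punchIn-strictMono : ∀ (p : Fin (1 + n)) {i j : Fin n} → toℕ i < toℕ j → toℕ (punchIn p i) < toℕ (punchIn p j)
punchIn-strictMono p {i} {j} i<j =
  ℕ.≤∧≢⇒< (Fin.punchIn-mono-≤ p i j (ℕ.<⇒≤ i<j))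
          (λ eq → ℕ.<-irrefl (cong toℕ (Fin.punchIn-injective p i j (Fin.toℕ-injective eq))) i<j)

punchIn-suc-self : ∀ (i : Fin n) → punchIn (suc i) i ≡ inject₁ i
punchIn-suc-self zero = refl
punchIn-suc-self (suc i) = cong suc (punchIn-suc-self i)

toℕ-suc-inject₁ : ∀ (i : Fin n) → toℕ (suc (inject₁ i)) ≡ 1 + toℕ i
toℕ-suc-inject₁ i = cong ℕ.suc (Fin.toℕ-inject₁ i)

suc≡inject₁⇒< : ∀ {i j : Fin n} → suc i ≡ inject₁ j → toℕ i < toℕ j
suc≡inject₁⇒< {j = j} eq = ℕ.≤-reflexive (trans (cong toℕ eq) (Fin.toℕ-inject₁ j))

map-injective : ∀ {A B : Set} {f : A → B} → (∀ {x y} → f x ≡ f y → x ≡ y) →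
  {xs ys : Vec A m} → Vec.map f xs ≡ Vec.map f ys → xs ≡ ys
map-injective f-inj {[]} {[]} _ = refl
map-injective f-inj {x ∷ xs} {y ∷ ys} eq =
  cong₂ _∷_ (f-inj (Vec.∷-injectiveˡ eq)) (map-injective f-inj (Vec.∷-injectiveʳ eq))

lookup-removeAt : ∀ {A : Set} (xs : Vec A (1 + m)) i y → lookup (removeAt xs i) y ≡ lookup xs (punchIn i y)
lookup-removeAt xs i y =
  trans (sym (Vec.insertAt-punchIn (removeAt xs i) i (lookup xs i) y))
        (cong (λ ys → lookup ys (punchIn i y)) (Vec.insertAt-removeAt xs i))

insertAt-removeAt-lookup : ∀ {A : Set} (xs : Vec A (1 + m)) i {v} → lookup xs i ≡ v → insertAt (removeAt xs i) i v ≡ xs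
insertAt-removeAt-lookup xs i refl = Vec.insertAt-removeAt xs i

nonzero⇒map-suc : (r : Vec (Fin (1 + k)) m) → (∀ y → lookup r y ≢ zero) → ∃[ u ] Vec.map suc u ≡ r
nonzero⇒map-suc [] _ = [] , refl
nonzero⇒map-suc (zero ∷ r) r≢0 = ⊥-elim (r≢0 zero refl)
nonzero⇒map-suc (suc x ∷ r) r≢0 with nonzero⇒map-suc r (r≢0 ∘ suc)
... | u , refl = x ∷ u , refl

ZerosAdjacent : Word m (1 + k) → Set
ZerosAdjacent {m} ω = ∀ {a c : Fin m} → lookup ω a ≡ zero → lookup ω c ≡ zero → toℕ c ≤ 1 + toℕ a

ZerosAdjacent⇒nothing-between : (ω : Word m (1 + k)) → ZerosAdjacent ω → ∀ {a b c : Fin m} →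
  lookup ω a ≡ zero → lookup ω c ≡ zero → toℕ a < toℕ b → toℕ b < toℕ c → ⊥
ZerosAdjacent⇒nothing-between ω adj ωa≡0 ωc≡0 a<b b<c = ℕ.<⇒≱ (ℕ.≤-<-trans a<b b<c) (adj ωa≡0 ωc≡0)

nothing-between-zeros : (ω : Word m (1 + k)) → ¬ Contains010 ω → ¬ Contains000 ω → ∀ {a b c : Fin m} →
  lookup ω a ≡ zero → lookup ω c ≡ zero → toℕ a < toℕ b → toℕ b < toℕ c → ⊥
nothing-between-zeros ω ¬010 ¬000 {a} {b} {c} ωa≡0 ωc≡0 a<b b<c with lookup ω b ≟ zero
... | yes ωb≡0 = ¬000 (a , b , c , a<b , b<c , trans ωa≡0 (sym ωb≡0) , trans ωb≡0 (sym ωc≡0))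
... | no ωb≢0 = ¬010 (a , b , c , a<b , b<c , trans ωa≡0 (sym ωc≡0) , ωa<ωb)
  where
  ωa<ωb = subst (λ x → toℕ x < toℕ (lookup ω b)) (sym ωa≡0) (Fin.≤∧≢⇒< z≤n (ωb≢0 ∘ sym))

avoiding⇒ZerosAdjacent : (ω : Word m (1 + k)) → ¬ Contains010 ω → ¬ Contains000 ω → ZerosAdjacent ω
avoiding⇒ZerosAdjacent ω ¬010 ¬000 {a} {c} ωa≡0 ωc≡0 with toℕ c ℕ.≤? 1 + toℕ a
... | yes c≤a+1 = c≤a+1
... | no c≰a+1 = ⊥-elim (nothing-between-zeros ω ¬010 ¬000 ωa≡0 ωc≡0 a<b b<c)
  where
  a+1<c = ℕ.≰⇒> c≰a+1
  b≡a+1 = Fin.toℕ-fromℕ< (ℕ.<-trans a+1<c (Fin.toℕ<n c))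
  a<b = ℕ.≤-reflexive (sym b≡a+1)
  b<c = subst (_< toℕ c) (sym b≡a+1) a+1<c

-- v arises from u by raising every letter by one and inserting a block of at most two zeros.
record Lift {m M k} (u : Word m k) (v : Word M (1 + k)) : Set where
  field
    embed          : Fin m → Fin M
    embed-mono     : ∀ {i j} → toℕ i < toℕ j → toℕ (embed i) < toℕ (embed j)
    lookup-embed   : ∀ i → lookup v (embed i) ≡ suc (lookup u i)
    zero-or-embed  : ∀ x → lookup v x ≡ zero ⊎ ∃[ i ] embed i ≡ x
    zeros-adjacent : ZerosAdjacent v

module LiftProperties {m M k} {u : Word m k} {v : Word M (1 + k)} (s : Lift u v) where
  open Lift s

  embed-reflects-< : ∀ {i j} → toℕ (embed i) < toℕ (embed j) → toℕ i < toℕ j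
  embed-reflects-< {i} {j} ei<ej with Fin.<-cmp i j
  ... | tri< i<j _ _ = i<j
  ... | tri≈ _ refl _ = ⊥-elim (ℕ.<-irrefl refl ei<ej)
  ... | tri> _ _ j<i = ⊥-elim (ℕ.<-asym ei<ej (embed-mono j<i))

  nonzero⇒embedded : ∀ x → lookup v x ≢ zero → ∃[ i ] embed i ≡ x
  nonzero⇒embedded x vx≢0 with zero-or-embed x
  ... | inj₁ vx≡0 = ⊥-elim (vx≢0 vx≡0)
  ... | inj₂ i,ei≡x = i,ei≡x

  lookup-embed-injective : ∀ {i j} → lookup v (embed i) ≡ lookup v (embed j) → lookup u i ≡ lookup u j
  lookup-embed-injective {i} {j} eq = Fin.suc-injective (trans (sym (lookup-embed i)) (trans eq (lookup-embed j)))

  lookup-embed-reflects-< : ∀ {i j} → toℕ (lookup v (embed i)) < toℕ (lookup v (embed j)) →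
                            toℕ (lookup u i) < toℕ (lookup u j)
  lookup-embed-reflects-< {i} {j} lt =
    ℕ.≤-pred (subst₂ (λ x y → toℕ x < toℕ y) (lookup-embed i) (lookup-embed j) lt)

  lift-010 : Contains010 u → Contains010 v
  lift-010 (a , b , c , a<b , b<c , ua≡uc , ua<ub) =
    embed a , embed b , embed c , embed-mono a<b , embed-mono b<c ,
    trans (lookup-embed a) (trans (cong suc ua≡uc) (sym (lookup-embed c))) ,
    subst₂ (λ x y → toℕ x < toℕ y) (sym (lookup-embed a)) (sym (lookup-embed b)) (s≤s ua<ub)

  lift-000 : Contains000 u → Contains000 v
  lift-000 (a , b , c , a<b , b<c , ua≡ub , ub≡uc) =
    embed a , embed b , embed c , embed-mono a<b , embed-mono b<c ,
    trans (lookup-embed a) (trans (cong suc ua≡ub) (sym (lookup-embed b))) ,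
    trans (lookup-embed b) (trans (cong suc ub≡uc) (sym (lookup-embed c)))

  unlift-010 : Contains010 v → Contains010 u
  unlift-010 (a , b , c , a<b , b<c , va≡vc , va<vb) with lookup v a ≟ zero
  ... | yes va≡0 = ⊥-elim (ZerosAdjacent⇒nothing-between v zeros-adjacent va≡0 (trans (sym va≡vc) va≡0) a<b b<c)
  ... | no va≢0
    with nonzero⇒embedded a va≢0
       | nonzero⇒embedded b (λ vb≡0 → ℕ.n≮0 (subst (λ x → toℕ (lookup v a) < toℕ x) vb≡0 va<vb))
       | nonzero⇒embedded c (va≢0 ∘ trans va≡vc)
  ... | i , refl | j , refl | l , refl =
    i , j , l , embed-reflects-< a<b , embed-reflects-< b<c ,
    lookup-embed-injective va≡vc , lookup-embed-reflects-< va<vb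

  unlift-000 : Contains000 v → Contains000 u
  unlift-000 (a , b , c , a<b , b<c , va≡vb , vb≡vc) with lookup v a ≟ zero
  ... | yes va≡0 = ⊥-elim (ZerosAdjacent⇒nothing-between v zeros-adjacent va≡0 (trans (sym (trans va≡vb vb≡vc)) va≡0) a<b b<c)
  ... | no va≢0
    with nonzero⇒embedded a va≢0
       | nonzero⇒embedded b (va≢0 ∘ trans va≡vb)
       | nonzero⇒embedded c (va≢0 ∘ trans (trans va≡vb vb≡vc))
  ... | i , refl | j , refl | l , refl =
    i , j , l , embed-reflects-< a<b , embed-reflects-< b<c ,
    lookup-embed-injective va≡vb , lookup-embed-injective vb≡vc

  lift-surjective : ∃[ x ] lookup v x ≡ zero → Surjective u → Surjective v
  lift-surjective v-has-0 su zero = v-has-0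
  lift-surjective v-has-0 su (suc y) with su y
  ... | i , ui≡y = embed i , trans (lookup-embed i) (cong suc ui≡y)

  unlift-surjective : Surjective v → Surjective u
  unlift-surjective sv y with sv (suc y)
  ... | x , vx≡y+1 with nonzero⇒embedded x (λ vx≡0 → Fin.0≢1+n (trans (sym vx≡0) vx≡y+1))
  ... | i , refl = i , Fin.suc-injective (trans (sym (lookup-embed i)) vx≡y+1)

InC-Lift : {u : Word (1 + m) (1 + k)} {v : Word (1 + n) (2 + k)} (s : Lift u v) →
  Lift.embed s zero ≡ zero → ∃[ x ] lookup v x ≡ zero → InC (1 + m) (1 + k) u ⇔ InC (1 + n) (2 + k) v
InC-Lift {u = u} {v} s embed0≡0 v-has-0 = mk⇔
  (λ { (inC _ ¬010 ¬000 su u0≡top) →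
       inC v (¬010 ∘ unlift-010) (¬000 ∘ unlift-000) (lift-surjective v-has-0 su)
           (trans (cong (lookup v) (sym embed0≡0)) (trans (lookup-embed zero) (cong suc u0≡top))) })
  (λ { (inC _ ¬010 ¬000 sv v0≡top) →
       inC u (¬010 ∘ lift-010) (¬000 ∘ lift-000) (unlift-surjective sv)
           (Fin.suc-injective (trans (sym (lookup-embed zero)) (trans (cong (lookup v) embed0≡0) v0≡top))) })
  where
  open Lift s
  open LiftProperties s

-- The new smallest letter goes right after position t, so it never becomes the first letter.
insert0 : Fin m → Word m k → Word (1 + m) (1 + k)
insert0 t ω = insertAt (Vec.map suc ω) (suc t) zero

insert00 : Fin m → Word m k → Word (2 + m) (1 + k)
insert00 t ω = insertAt (insert0 t ω) (suc (suc t)) zero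

module _ (t : Fin m) (ω : Word m k) where

  lookup-insert0-punchIn : ∀ i → lookup (insert0 t ω) (punchIn (suc t) i) ≡ suc (lookup ω i)
  lookup-insert0-punchIn i = trans (Vec.insertAt-punchIn (Vec.map suc ω) (suc t) zero i) (Vec.lookup-map i suc ω)

  lookup-insert0 : lookup (insert0 t ω) (suc t) ≡ zero
  lookup-insert0 = Vec.insertAt-lookup (Vec.map suc ω) (suc t) zero

  insert0-zero⇒ : ∀ {x} → lookup (insert0 t ω) x ≡ zero → x ≡ suc t
  insert0-zero⇒ {x} ωx≡0 with punchIn-or-pivot (suc t) x
  ... | inj₁ x≡t+1 = x≡t+1
  ... | inj₂ (i , refl) = ⊥-elim (Fin.0≢1+n (trans (sym ωx≡0) (lookup-insert0-punchIn i)))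

  removeAt-insert0 : removeAt (insert0 t ω) (suc t) ≡ Vec.map suc ω
  removeAt-insert0 = Vec.removeAt-insertAt (Vec.map suc ω) (suc t) zero

  insert0-Lift : Lift ω (insert0 t ω)
  insert0-Lift = record
    { embed          = punchIn (suc t)
    ; embed-mono     = punchIn-strictMono (suc t)
    ; lookup-embed   = lookup-insert0-punchIn
    ; zero-or-embed  = λ x → Sum.map₁ (λ { refl → lookup-insert0 }) (punchIn-or-pivot (suc t) x)
    ; zeros-adjacent = λ ωa≡0 ωc≡0 →
        ℕ.m≤n⇒m≤1+n (ℕ.≤-reflexive (cong toℕ (trans (insert0-zero⇒ ωc≡0) (sym (insert0-zero⇒ ωa≡0)))))
    }

  lookup-insert00-embed : ∀ i → lookup (insert00 t ω) (punchIn (suc (suc t)) (punchIn (suc t) i)) ≡ suc (lookup ω i)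
  lookup-insert00-embed i =
    trans (Vec.insertAt-punchIn (insert0 t ω) (suc (suc t)) zero (punchIn (suc t) i)) (lookup-insert0-punchIn i)

  lookup-insert00₁ : lookup (insert00 t ω) (suc (inject₁ t)) ≡ zero
  lookup-insert00₁ = begin
    lookup (insert00 t ω) (suc (inject₁ t))                 ≡⟨ cong (lookup (insert00 t ω) ∘ suc) (punchIn-suc-self t) ⟨
    lookup (insert00 t ω) (punchIn (suc (suc t)) (suc t))   ≡⟨ Vec.insertAt-punchIn (insert0 t ω) (suc (suc t)) zero (suc t) ⟩
    lookup (insert0 t ω) (suc t)                            ≡⟨ lookup-insert0 ⟩
    zero                                                    ∎
    where open ≡-Reasoning

  lookup-insert00₂ : lookup (insert00 t ω) (suc (suc t)) ≡ zero
  lookup-insert00₂ = Vec.insertAt-lookup (insert0 t ω) (suc (suc t)) zero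

  insert00-zero⇒ : ∀ {x} → lookup (insert00 t ω) x ≡ zero → x ≡ suc (inject₁ t) ⊎ x ≡ suc (suc t)
  insert00-zero⇒ {x} ωx≡0 with punchIn-or-pivot (suc (suc t)) x
  ... | inj₁ x≡t+2 = inj₂ x≡t+2
  ... | inj₂ (y , refl) =
    inj₁ (trans (cong (punchIn (suc (suc t))) (insert0-zero⇒ ωy≡0)) (cong suc (punchIn-suc-self t)))
    where
    ωy≡0 = trans (sym (Vec.insertAt-punchIn (insert0 t ω) (suc (suc t)) zero y)) ωx≡0

  toℕ-insert00-zero : ∀ {x} → lookup (insert00 t ω) x ≡ zero → 1 + toℕ t ≤ toℕ x × toℕ x ≤ 2 + toℕ t
  toℕ-insert00-zero ωx≡0 with insert00-zero⇒ ωx≡0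
  ... | inj₁ refl = ℕ.≤-reflexive (sym (toℕ-suc-inject₁ t)) , ℕ.m≤n⇒m≤1+n (ℕ.≤-reflexive (toℕ-suc-inject₁ t))
  ... | inj₂ refl = ℕ.n≤1+n (1 + toℕ t) , ℕ.≤-refl

  removeAt-insert00 : removeAt (removeAt (insert00 t ω) (suc (suc t))) (suc t) ≡ Vec.map suc ω
  removeAt-insert00 =
    trans (cong (λ v → removeAt v (suc t)) (Vec.removeAt-insertAt (insert0 t ω) (suc (suc t)) zero)) removeAt-insert0

  insert00-zero-or-embed : ∀ x → lookup (insert00 t ω) x ≡ zero ⊎ ∃[ i ] punchIn (suc (suc t)) (punchIn (suc t) i) ≡ x
  insert00-zero-or-embed x with punchIn-or-pivot (suc (suc t)) x
  ... | inj₁ refl = inj₁ lookup-insert00₂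
  ... | inj₂ (y , refl) with Lift.zero-or-embed insert0-Lift y
  ...   | inj₁ ωy≡0 = inj₁ (trans (Vec.insertAt-punchIn (insert0 t ω) (suc (suc t)) zero y) ωy≡0)
  ...   | inj₂ (i , refl) = inj₂ (i , refl)

  insert00-Lift : Lift ω (insert00 t ω)
  insert00-Lift = record
    { embed          = punchIn (suc (suc t)) ∘ punchIn (suc t)
    ; embed-mono     = punchIn-strictMono (suc (suc t)) ∘ punchIn-strictMono (suc t)
    ; lookup-embed   = lookup-insert00-embed
    ; zero-or-embed  = insert00-zero-or-embed
    ; zeros-adjacent = λ ωa≡0 ωc≡0 → ℕ.≤-trans (proj₂ (toℕ-insert00-zero ωc≡0)) (s≤s (proj₁ (toℕ-insert00-zero ωa≡0)))
    }

zero-transport : ∀ {v w : Word m (1 + k)} {x} → v ≡ w → lookup v x ≡ zero → lookup w x ≡ zero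
zero-transport {x = x} v≡w = subst (λ w → lookup w x ≡ zero) v≡w

insert0-injective : ∀ {t t' : Fin m} {u u' : Word m k} → insert0 t u ≡ insert0 t' u' → (t , u) ≡ (t' , u')
insert0-injective {t = t} {t'} {u} {u'} eq
  with Fin.suc-injective (insert0-zero⇒ t' u' (zero-transport eq (lookup-insert0 t u)))
... | refl = cong (t ,_) (map-injective Fin.suc-injective (begin
  Vec.map suc u                     ≡⟨ removeAt-insert0 t u ⟨
  removeAt (insert0 t u) (suc t)    ≡⟨ cong (λ v → removeAt v (suc t)) eq ⟩
  removeAt (insert0 t u') (suc t)   ≡⟨ removeAt-insert0 t u' ⟩
  Vec.map suc u'                    ∎))
  where open ≡-Reasoning

insert00-position-injective : ∀ {t t' : Fin m} {u u' : Word m k} → insert00 t u ≡ insert00 t' u' → t ≡ t'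
insert00-position-injective {t = t} {t'} {u} {u'} eq
  with insert00-zero⇒ t' u' (zero-transport eq (lookup-insert00₂ t u))
     | insert00-zero⇒ t u (zero-transport (sym eq) (lookup-insert00₂ t' u'))
... | inj₂ t+2≡t'+2 | _ = Fin.suc-injective (Fin.suc-injective t+2≡t'+2)
... | inj₁ _ | inj₂ t'+2≡t+2 = Fin.suc-injective (Fin.suc-injective (sym t'+2≡t+2))
... | inj₁ t+2≡t'+1 | inj₁ t'+2≡t+1 =
  ⊥-elim (ℕ.<-asym (suc≡inject₁⇒< (Fin.suc-injective t+2≡t'+1)) (suc≡inject₁⇒< (Fin.suc-injective t'+2≡t+1)))

insert00-injective : ∀ {t t' : Fin m} {u u' : Word m k} → insert00 t u ≡ insert00 t' u' → (t , u) ≡ (t' , u')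
insert00-injective {t = t} {t'} {u} {u'} eq with insert00-position-injective eq
... | refl = cong (t ,_) (map-injective Fin.suc-injective (begin
  Vec.map suc u                                              ≡⟨ removeAt-insert00 t u ⟨
  removeAt (removeAt (insert00 t u) (suc (suc t))) (suc t)   ≡⟨ cong (λ v → removeAt (removeAt v (suc (suc t))) (suc t)) eq ⟩
  removeAt (removeAt (insert00 t u') (suc (suc t))) (suc t)  ≡⟨ removeAt-insert00 t u' ⟩
  Vec.map suc u'                                             ∎))
  where open ≡-Reasoning

insert0≢insert00 : ∀ {t : Fin (1 + m)} {t' : Fin m} {u : Word (1 + m) k} {u' : Word m k} → insert0 t u ≢ insert00 t' u'
insert0≢insert00 {t = t} {t'} {u} {u'} eq = ℕ.<-irrefl refl (suc≡inject₁⇒< (Fin.suc-injective (sym t'+1≡t'+2)))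
  where
  t'+1≡t'+2 : suc (inject₁ t') ≡ suc (suc t')
  t'+1≡t'+2 = trans (insert0-zero⇒ t u (zero-transport (sym eq) (lookup-insert00₁ t' u')))
                    (sym (insert0-zero⇒ t u (zero-transport (sym eq) (lookup-insert00₂ t' u'))))

insert0-onto : (ω : Word (1 + m) (1 + k)) (t : Fin m) → lookup ω (suc t) ≡ zero →
  (∀ x → lookup ω x ≡ zero → x ≡ suc t) → ∃[ u ] insert0 t u ≡ ω
insert0-onto ω t ω[t+1]≡0 only-zero = proj₁ lowered , (begin
  insertAt (Vec.map suc (proj₁ lowered)) (suc t) zero  ≡⟨ cong (λ r → insertAt r (suc t) zero) (proj₂ lowered) ⟩
  insertAt (removeAt ω (suc t)) (suc t) zero          ≡⟨ insertAt-removeAt-lookup ω (suc t) ω[t+1]≡0 ⟩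
  ω                                                   ∎)
  where
  open ≡-Reasoning
  rest≢0 : ∀ y → lookup (removeAt ω (suc t)) y ≢ zero
  rest≢0 y r[y]≡0 = Fin.punchInᵢ≢i (suc t) y (only-zero _ (trans (sym (lookup-removeAt ω (suc t) y)) r[y]≡0))
  lowered = nonzero⇒map-suc (removeAt ω (suc t)) rest≢0

insert00-onto : (ω : Word (2 + m) (1 + k)) (t : Fin m) →
  lookup ω (suc (inject₁ t)) ≡ zero → lookup ω (suc (suc t)) ≡ zero →
  (∀ x → lookup ω x ≡ zero → x ≡ suc (inject₁ t) ⊎ x ≡ suc (suc t)) → ∃[ u ] insert00 t u ≡ ω
insert00-onto ω t ω[t+1]≡0 ω[t+2]≡0 only-zeros = proj₁ lowered , (begin
  insertAt (insert0 t (proj₁ lowered)) (suc (suc t)) zero  ≡⟨ cong (λ r → insertAt r (suc (suc t)) zero) (proj₂ lowered) ⟩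
  insertAt (removeAt ω (suc (suc t))) (suc (suc t)) zero   ≡⟨ insertAt-removeAt-lookup ω (suc (suc t)) ω[t+2]≡0 ⟩
  ω                                                        ∎)
  where
  open ≡-Reasoning
  r = removeAt ω (suc (suc t))
  punchIn-t+1 : punchIn (suc (suc t)) (suc t) ≡ suc (inject₁ t)
  punchIn-t+1 = cong suc (punchIn-suc-self t)
  r-zero⇒ : ∀ y → lookup r y ≡ zero → y ≡ suc t
  r-zero⇒ y r[y]≡0 with only-zeros _ (trans (sym (lookup-removeAt ω (suc (suc t)) y)) r[y]≡0)
  ... | inj₁ eq = Fin.punchIn-injective (suc (suc t)) y (suc t) (trans eq (sym punchIn-t+1))
  ... | inj₂ eq = ⊥-elim (Fin.punchInᵢ≢i (suc (suc t)) y eq)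
  r[t+1]≡0 : lookup r (suc t) ≡ zero
  r[t+1]≡0 = trans (lookup-removeAt ω (suc (suc t)) (suc t)) (trans (cong (lookup ω) punchIn-t+1) ω[t+1]≡0)
  lowered = insert0-onto r t r[t+1]≡0 r-zero⇒

≤∧≤1+⇒≡⊎≡1+ : ∀ {a x} → a ≤ x → x ≤ 1 + a → x ≡ a ⊎ x ≡ 1 + a
≤∧≤1+⇒≡⊎≡1+ a≤x x≤1+a = Sum.map₁ (λ x<1+a → ℕ.≤-antisym (ℕ.≤-pred x<1+a) a≤x) (ℕ.m≤n⇒m<n∨m≡n x≤1+a)

module _ (ω : Word m (1 + k)) (adj : ZerosAdjacent ω) {a c : Fin m}
         (ωa≡0 : lookup ω a ≡ zero) (ωc≡0 : lookup ω c ≡ zero) (a<c : toℕ a < toℕ c) where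

  ZerosAdjacent⇒successor : toℕ c ≡ 1 + toℕ a
  ZerosAdjacent⇒successor = ℕ.≤-antisym (adj ωa≡0 ωc≡0) a<c

  ZerosAdjacent⇒only-zeros : ∀ {x} → lookup ω x ≡ zero → x ≡ a ⊎ x ≡ c
  ZerosAdjacent⇒only-zeros ωx≡0 =
    Sum.map Fin.toℕ-injective (λ x≡1+a → Fin.toℕ-injective (trans x≡1+a (sym ZerosAdjacent⇒successor)))
      (≤∧≤1+⇒≡⊎≡1+ (ℕ.≤-pred (subst (_≤ 1 + toℕ _) ZerosAdjacent⇒successor (adj ωx≡0 ωc≡0))) (adj ωa≡0 ωx≡0))

two-zeros⇒insert00 : (ω : Word (2 + m) (1 + k)) → ZerosAdjacent ω → lookup ω zero ≢ zero →
  ∀ {a c} → lookup ω a ≡ zero → lookup ω c ≡ zero → toℕ a < toℕ c → ∃₂ λ t u → insert00 t u ≡ ω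
two-zeros⇒insert00 ω adj ω0≢0 {zero} ω0≡0 _ _ = ⊥-elim (ω0≢0 ω0≡0)
two-zeros⇒insert00 ω adj ω0≢0 {suc a} {suc zero} _ _ (s≤s ())
two-zeros⇒insert00 ω adj ω0≢0 {suc a} {suc (suc t)} ωa≡0 ωc≡0 a<c =
  t , insert00-onto ω t (subst (λ x → lookup ω x ≡ zero) a≡t+1 ωa≡0) ωc≡0
        (λ x ωx≡0 → Sum.map₁ (λ x≡a → trans x≡a a≡t+1) (ZerosAdjacent⇒only-zeros ω adj ωa≡0 ωc≡0 a<c ωx≡0))
  where
  a≡t+1 : suc a ≡ suc (inject₁ t)
  a≡t+1 = Fin.toℕ-injective
    (trans (ℕ.suc-injective (sym (ZerosAdjacent⇒successor ω adj ωa≡0 ωc≡0 a<c))) (sym (toℕ-suc-inject₁ t)))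

zero-block-decomposition : (ω : Word (2 + m) (1 + k)) → ZerosAdjacent ω → lookup ω zero ≢ zero →
  ∀ i → lookup ω i ≡ zero → (∃₂ λ t u → insert0 t u ≡ ω) ⊎ (∃₂ λ t u → insert00 t u ≡ ω)
zero-block-decomposition ω adj ω0≢0 zero ω0≡0 = ⊥-elim (ω0≢0 ω0≡0)
zero-block-decomposition ω adj ω0≢0 (suc t) ω[t+1]≡0
  with Fin.any? (λ j → ¬? (j ≟ suc t) ×-dec (lookup ω j ≟ zero))
... | yes (j , j≢t+1 , ωj≡0) with Fin.<-cmp (suc t) j
...   | tri< t+1<j _ _ = inj₂ (two-zeros⇒insert00 ω adj ω0≢0 ω[t+1]≡0 ωj≡0 t+1<j)
...   | tri≈ _ t+1≡j _ = ⊥-elim (j≢t+1 (sym t+1≡j))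
...   | tri> _ _ j<t+1 = inj₂ (two-zeros⇒insert00 ω adj ω0≢0 ωj≡0 ω[t+1]≡0 j<t+1)
zero-block-decomposition ω adj ω0≢0 (suc t) ω[t+1]≡0
    | no no-other-zero = inj₁ (t , insert0-onto ω t ω[t+1]≡0 only-zero)
  where
  only-zero : ∀ x → lookup ω x ≡ zero → x ≡ suc t
  only-zero x ωx≡0 with x ≟ suc t
  ... | yes x≡t+1 = x≡t+1
  ... | no x≢t+1 = ⊥-elim (no-other-zero (x , x≢t+1 , ωx≡0))

InC⇒insert0⊎insert00 : {ω : Word (2 + m) (2 + k)} → InC (2 + m) (2 + k) ω →
  (∃₂ λ t u → insert0 t u ≡ ω) ⊎ (∃₂ λ t u → insert00 t u ≡ ω)
InC⇒insert0⊎insert00 (inC ω ¬010 ¬000 surjective ω0≡top) =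
  zero-block-decomposition ω (avoiding⇒ZerosAdjacent ω ¬010 ¬000)
    (λ ω0≡0 → Fin.0≢1+n (trans (sym ω0≡0) ω0≡top)) (proj₁ (surjective zero)) (proj₂ (surjective zero))

InC-insert0 : (t : Fin (1 + m)) (u : Word (1 + m) (1 + k)) → InC (1 + m) (1 + k) u ⇔ InC (2 + m) (2 + k) (insert0 t u)
InC-insert0 t u = InC-Lift (insert0-Lift t u) refl (suc t , lookup-insert0 t u)

InC-insert00 : (t : Fin m) (u : Word m (1 + k)) → InC m (1 + k) u ⇔ InC (2 + m) (2 + k) (insert00 t u)
InC-insert00 {m = ℕ.suc _} t u = InC-Lift (insert00-Lift t u) refl (suc (suc t) , lookup-insert00₂ t u)

module Encoding (n k : ℕ) where

  Code : Set
  Code = (Fin (1 + n) × Word (1 + n) (1 + k)) ⊎ (Fin n × Word n (1 + k))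

  decode : Code → Word (2 + n) (2 + k)
  decode (inj₁ (t , u)) = insert0 t u
  decode (inj₂ (t , u)) = insert00 t u

  decode-injective : ∀ {c c'} → decode c ≡ decode c' → c ≡ c'
  decode-injective {inj₁ _} {inj₁ _} eq = cong inj₁ (insert0-injective eq)
  decode-injective {inj₁ _} {inj₂ _} eq = ⊥-elim (insert0≢insert00 eq)
  decode-injective {inj₂ _} {inj₁ _} eq = ⊥-elim (insert0≢insert00 (sym eq))
  decode-injective {inj₂ _} {inj₂ _} eq = cong inj₂ (insert00-injective eq)

  codes : List (Word (1 + n) (1 + k)) → List (Word n (1 + k)) → List Code
  codes L₁ L₂ = tagged (cartesianProduct (allFin (1 + n)) L₁) (cartesianProduct (allFin n) L₂)

  length-codes : ∀ L₁ L₂ → length (codes L₁ L₂) ≡ (1 + n) * length L₁ + n * length L₂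
  length-codes L₁ L₂ =
    trans (length-tagged {xs = cartesianProduct (allFin (1 + n)) L₁} {ys = cartesianProduct (allFin n) L₂})
          (cong₂ _+_ (length-allFin-product (1 + n) L₁) (length-allFin-product n L₂))

  codes-unique : ∀ {L₁ L₂} → Unique L₁ → Unique L₂ → Unique (codes L₁ L₂)
  codes-unique L₁! L₂! =
    tagged-unique (Unique.cartesianProduct⁺ (Unique.allFin⁺ (1 + n)) L₁!) (Unique.cartesianProduct⁺ (Unique.allFin⁺ n) L₂!)

  module _ {L L₁ L₂} (enum : Enumerates (2 + n) (2 + k) L)
           (enum₁ : Enumerates (1 + n) (1 + k) L₁) (enum₂ : Enumerates n (1 + k) L₂) where
    open Equivalence

    decode-∈ : ∀ {c} → c ∈ codes L₁ L₂ → decode c ∈ L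
    decode-∈ {inj₁ (t , u)} c∈ = from (proj₂ enum _)
      (to (InC-insert0 t u) (to (proj₂ enum₁ u) (proj₂ (∈-cartesianProduct⁻ (allFin (1 + n)) L₁ (∈-taggedˡ⁻ c∈)))))
    decode-∈ {inj₂ (t , u)} c∈ = from (proj₂ enum _)
      (to (InC-insert00 t u) (to (proj₂ enum₂ u) (proj₂ (∈-cartesianProduct⁻ (allFin n) L₂ (∈-taggedʳ⁻ c∈)))))

    decode-onto : ∀ {ω} → ω ∈ L → ∃[ c ] (c ∈ codes L₁ L₂ × decode c ≡ ω)
    decode-onto ω∈ with to (proj₂ enum _) ω∈
    ... | ω∈C with InC⇒insert0⊎insert00 ω∈C
    ...   | inj₁ (t , u , refl) = inj₁ (t , u) ,
      ∈-taggedˡ⁺ (∈-cartesianProduct⁺ (∈-allFin t) (from (proj₂ enum₁ u) (from (InC-insert0 t u) ω∈C))) , refl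
    ...   | inj₂ (t , u , refl) = inj₂ (t , u) ,
      ∈-taggedʳ⁺ (∈-cartesianProduct⁺ (∈-allFin t) (from (proj₂ enum₂ u) (from (InC-insert00 t u) ω∈C))) , refl

lemma2 : (n k : ℕ) → (L : List (Word (2 + n) (2 + k))) → (L₁ : List (Word (1 + n) (1 + k))) → (L₂ : List (Word n (1 + k))) →
    Enumerates (2 + n) (2 + k) L → Enumerates (1 + n) (1 + k) L₁ → Enumerates n (1 + k) L₂ →
    length L ≡ (1 + n) * length L₁ + n * length L₂
lemma2 n k L L₁ L₂ enum enum₁ enum₂ = begin
  length L              ≡⟨ length-≡-by-bijection decode (codes-unique (proj₁ enum₁) (proj₁ enum₂)) (proj₁ enum)
                             decode-injective (decode-∈ enum enum₁ enum₂) (decode-onto enum enum₁ enum₂) ⟩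
  length (codes L₁ L₂)  ≡⟨ length-codes L₁ L₂ ⟩
  (1 + n) * length L₁ + n * length L₂ ∎
  where
  open Encoding n k
  open ≡-Reasoning
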